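{- Let $G$ be a connected graph, and let $A, B$ be two linked and convex subsets of $V(G)$. Then $A$ and $B$ are separable if and only if $S(A,B)$ and $S(B,A)$ are separable.
   Context: All graphs are finite, undirected and loopless. A chordless $uv$-path is a $uv$-path that is an induced subgraph. A set $C\subseteq V(G)$ is convex (monophonically convex) if for all $u,v\in C$ every vertex on a chordless $uv$-path lies in $C$; $\mathrm{cl}(X)$ is the intersection of all convex sets containing $X$. A half-space is a convex set $H$ with $V(G)\setminus H$ convex; $X,Y$ are separable if there is a half-space $H$ with $X\subseteq H$, $Y\subseteq V(G)\setminus H$. $A,B$ are linked if some vertex of $A$ is adjacent to some vertex of $B$. For $X,Y\subseteq V(G)$: $X/Y = \{v : \mathrm{cl}(Y\cup\{v\})\cap X\ne\emptyset\}$; a set $Z\subseteq V(G)\setminus(X\cup Y)$ is forbidden if $\mathrm{cl}(Z)$ meets both $X$ and $Y$, and $\mathrm{mfs}(X,Y)$ is the family of inclusion-minimal forbidden sets; $\sigma(X,Y) = \mathrm{cl}\big(X/Y\cup\bigcup\{\bigcap_{z\in Z}\mathrm{cl}(X\cup\{z\}) : Z\in\mathrm{mfs}(X,Y)\}\big)$. The saturation is $S(A,B) = \bigcup_{i\ge0}\sigma(A_i,B_i)$ where $A_0=A$, $B_0=B$, $A_i=\sigma(A_{i-1},B_{i-1})$ and $B_i=\sigma(B_{i-1},A_{i-1})$ for $i\ge1$; $S(B,A)$ is defined symmetrically. -}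

module Defs where

open import Data.Nat using (ℕ; zero; suc)
open import Data.Fin using (Fin; toℕ; fromℕ) renaming (zero to fzero)
open import Data.Fin.Subset using (Subset; _∈_; _∉_; ∁; _⊆_)
open import Data.Product using (Σ; ∃; _×_; _,_; proj₁; proj₂)
open import Data.Sum using (_⊎_)
open import Relation.Nullary using (¬_)
open import Relation.Binary.PropositionalEquality using (_≡_)
open import Function.Definitions using (Injective)

record Graph (n : ℕ) : Set₁ where
  field
    Adj     : Fin n → Fin n → Set
    symAdj  : ∀ {u v} → Adj u v → Adj v u
    irrefl  : ∀ {u} → ¬ Adj u u

VSet : ℕ → Set₁
VSet n = Fin n → Set

⟦_⟧ : ∀ {n} → Subset n → VSet n
⟦ Z ⟧ v = v ∈ Z

_∪_ : ∀ {n} → VSet n → VSet n → VSet n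
(X ∪ Y) v = X v ⊎ Y v

｛_｝ : ∀ {n} → Fin n → VSet n
｛ u ｝ v = v ≡ u

_⊆ᵖ_ : ∀ {n} → VSet n → VSet n → Set
X ⊆ᵖ Y = ∀ v → X v → Y v

Consec : ∀ {k} → Fin k → Fin k → Set
Consec i j = (toℕ j ≡ suc (toℕ i)) ⊎ (toℕ i ≡ suc (toℕ j))

module _ {n : ℕ} (G : Graph n) where
  open Graph G

  record ChordlessPath (u v : Fin n) : Set where
    field
      len      : ℕ
      vtx      : Fin (suc len) → Fin n
      distinct : Injective _≡_ _≡_ vtx
      start    : vtx fzero ≡ u
      end      : vtx (fromℕ len) ≡ v
      induced  : ∀ i j → (Adj (vtx i) (vtx j) → Consec i j)
                       × (Consec i j → Adj (vtx i) (vtx j))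

  data Walk : Fin n → Fin n → Set where
    here : ∀ {u} → Walk u u
    step : ∀ {u w v} → Adj u w → Walk w v → Walk u v

  Connected : Set
  Connected = ∀ u v → Walk u v

  Convex : VSet n → Set
  Convex C = ∀ u v → C u → C v → (P : ChordlessPath u v)
             → ∀ i → C (ChordlessPath.vtx P i)

  cl : VSet n → VSet n
  cl X v = ∀ (C : Subset n) → Convex ⟦ C ⟧ → X ⊆ᵖ ⟦ C ⟧ → v ∈ C

  HalfSpace : Subset n → Set
  HalfSpace H = Convex ⟦ H ⟧ × Convex ⟦ ∁ H ⟧

  Separable : VSet n → VSet n → Set
  Separable X Y = Σ (Subset n) λ H → HalfSpace H × X ⊆ᵖ ⟦ H ⟧ × Y ⊆ᵖ ⟦ ∁ H ⟧

  Linked : VSet n → VSet n → Set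
  Linked A B = ∃ λ a → ∃ λ b → A a × B b × Adj a b

  _／_ : VSet n → VSet n → VSet n
  (X ／ Y) v = ∃ λ w → cl (Y ∪ ｛ v ｝) w × X w

  Forbidden : VSet n → VSet n → Subset n → Set
  Forbidden X Y Z = (∀ z → z ∈ Z → ¬ X z × ¬ Y z)
                  × (∃ λ w → cl ⟦ Z ⟧ w × X w)
                  × (∃ λ w → cl ⟦ Z ⟧ w × Y w)

  MFS : VSet n → VSet n → Subset n → Set
  MFS X Y Z = Forbidden X Y Z × (∀ Z' → Z' ⊆ Z → Forbidden X Y Z' → Z ⊆ Z')

  σ : VSet n → VSet n → VSet n
  σ X Y = cl (λ v → (X ／ Y) v
               ⊎ (∃ λ Z → MFS X Y Z × (∀ z → z ∈ Z → cl (X ∪ ｛ z ｝) v)))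

  satSeq : VSet n → VSet n → ℕ → VSet n × VSet n
  satSeq A B zero = A , B
  satSeq A B (suc i) =
    let Ai = proj₁ (satSeq A B i) ; Bi = proj₂ (satSeq A B i)
    in σ Ai Bi , σ Bi Ai

  S : VSet n → VSet n → VSet n
  S A B v = ∃ λ i → σ (proj₁ (satSeq A B i)) (proj₂ (satSeq A B i)) v

{-# OPTIONS --safe #-}
-- A half-space H containing X and avoiding Y contains σ(X, Y): since V ∖ H is
-- convex, a vertex v ∉ H would give cl(Y ∪ {v}) ⊆ V ∖ H, and a forbidden set
-- Z ⊆ V ∖ H would give cl(Z) ⊆ V ∖ H, although both hulls meet X ⊆ H. So
-- X / Y ⊆ H, and every minimal forbidden Z has a z ∈ Z ∩ H, whence
-- ⋂_{z ∈ Z} cl(X ∪ {z}) ⊆ H. By induction H separates every pair (A_i, B_i).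
-- Conversely A ⊆ A / B ⊆ S(A, B).
module Submission where

open import Defs
open import Data.Nat using (ℕ; zero; suc)
open import Data.Fin.Properties using (any?)
open import Data.Fin.Subset using (Subset; _∈_; ∁)
open import Data.Fin.Subset.Properties
  using (_∈?_; x∈p⇒x∉∁p; x∉p⇒x∈∁p; x∉∁p⇒x∈p; ∪-∩-booleanAlgebra)
open import Data.Product using (∃; _×_; _,_; proj₁; proj₂)
open import Data.Sum using (_⊎_; inj₁; inj₂)
open import Function using (_∘_)
open import Function.Bundles using (_⇔_; mk⇔)
open import Relation.Nullary using (¬_)
open import Relation.Nullary.Decidable using (_×-dec_; decidable-stable)
open import Relation.Binary.PropositionalEquality using (_≡_; refl; sym; subst)
import Algebra.Lattice.Properties.BooleanAlgebra as BooleanAlgebraProperties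

∁-involutive : ∀ {n} (p : Subset n) → ∁ (∁ p) ≡ p
∁-involutive {n} = BooleanAlgebraProperties.¬-involutive (∪-∩-booleanAlgebra n)

∪-｛｝-⊆ : ∀ {n} {X : VSet n} {C : Subset n} {u} →
           X ⊆ᵖ ⟦ C ⟧ → u ∈ C → (X ∪ ｛ u ｝) ⊆ᵖ ⟦ C ⟧
∪-｛｝-⊆ X⊆C u∈C v (inj₁ v∈X) = X⊆C v v∈X
∪-｛｝-⊆ X⊆C u∈C v (inj₂ refl) = u∈C

module _ {n : ℕ} (G : Graph n) where

  cl-least : ∀ {X : VSet n} {C : Subset n} →
             Convex G ⟦ C ⟧ → X ⊆ᵖ ⟦ C ⟧ → cl G X ⊆ᵖ ⟦ C ⟧
  cl-least {C = C} C-convex X⊆C v v∈clX = v∈clX C C-convex X⊆C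

  ⊆-cl : ∀ (X : VSet n) → X ⊆ᵖ cl G X
  ⊆-cl X v v∈X C C-convex X⊆C = X⊆C v v∈X

  SeparatedBy : Subset n → VSet n → VSet n → Set
  SeparatedBy H X Y = HalfSpace G H × X ⊆ᵖ ⟦ H ⟧ × Y ⊆ᵖ ⟦ ∁ H ⟧

  separatedBy-sym : ∀ {H X Y} → SeparatedBy H X Y → SeparatedBy (∁ H) Y X
  separatedBy-sym {H} ((H-convex , ∁H-convex) , X⊆H , Y⊆∁H) =
    (∁H-convex , subst (Convex G ∘ ⟦_⟧) (sym (∁-involutive H)) H-convex) ,
    Y⊆∁H , λ v → x∉p⇒x∈∁p ∘ x∈p⇒x∉∁p ∘ X⊆H v

  separable-mono : ∀ {X X′ Y Y′ : VSet n} → X′ ⊆ᵖ X → Y′ ⊆ᵖ Y →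
                   Separable G X Y → Separable G X′ Y′
  separable-mono X′⊆X Y′⊆Y (H , H-halfSpace , X⊆H , Y⊆∁H) =
    H , H-halfSpace , (λ v → X⊆H v ∘ X′⊆X v) , (λ v → Y⊆∁H v ∘ Y′⊆Y v)

  module _ {H : Subset n} (∁H-convex : Convex G ⟦ ∁ H ⟧) where

    cl-meets⇒¬⊆∁ : ∀ {X w} → cl G X w → w ∈ H → ¬ (X ⊆ᵖ ⟦ ∁ H ⟧)
    cl-meets⇒¬⊆∁ w∈clX w∈H X⊆∁H = x∈p⇒x∉∁p w∈H (cl-least ∁H-convex X⊆∁H _ w∈clX)

    cl-meets⇒meets : ∀ {Z : Subset n} {w} → cl G ⟦ Z ⟧ w → w ∈ H →
                     ∃ λ z → z ∈ Z × z ∈ H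
    cl-meets⇒meets {Z} w∈clZ w∈H =
      decidable-stable (any? (λ z → z ∈? Z ×-dec z ∈? H)) λ Z∩H-empty →
        cl-meets⇒¬⊆∁ w∈clZ w∈H λ z z∈Z →
          x∉p⇒x∈∁p λ z∈H → Z∩H-empty (z , z∈Z , z∈H)

    ／-⊆ : ∀ {X Y} → X ⊆ᵖ ⟦ H ⟧ → Y ⊆ᵖ ⟦ ∁ H ⟧ → _／_ G X Y ⊆ᵖ ⟦ H ⟧
    ／-⊆ X⊆H Y⊆∁H v (w , w∈cl[Y∪v] , w∈X) =
      x∉∁p⇒x∈p λ v∈∁H → cl-meets⇒¬⊆∁ w∈cl[Y∪v] (X⊆H w w∈X) (∪-｛｝-⊆ Y⊆∁H v∈∁H)

  σ-generators : VSet n → VSet n → VSet n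
  σ-generators X Y v =
    _／_ G X Y v ⊎ (∃ λ Z → MFS G X Y Z × (∀ z → z ∈ Z → cl G (X ∪ ｛ z ｝) v))

  σ-⊆ : ∀ {H X Y} → SeparatedBy H X Y → σ G X Y ⊆ᵖ ⟦ H ⟧
  σ-⊆ {H} {X} {Y} ((H-convex , ∁H-convex) , X⊆H , Y⊆∁H) = cl-least H-convex generators-⊆
    where
    generators-⊆ : σ-generators X Y ⊆ᵖ ⟦ H ⟧
    generators-⊆ v (inj₁ v∈X／Y) = ／-⊆ ∁H-convex X⊆H Y⊆∁H v v∈X／Y
    generators-⊆ v (inj₂ (Z , ((_ , (w , w∈clZ , w∈X) , _) , _) , v∈hulls)) =
      let z , z∈Z , z∈H = cl-meets⇒meets ∁H-convex w∈clZ (X⊆H w w∈X)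
      in cl-least H-convex (∪-｛｝-⊆ X⊆H z∈H) v (v∈hulls z z∈Z)

  satSeq-separatedBy : ∀ {H A B} → SeparatedBy H A B →
                       ∀ i → SeparatedBy H (proj₁ (satSeq G A B i)) (proj₂ (satSeq G A B i))
  satSeq-separatedBy A|B zero = A|B
  satSeq-separatedBy A|B@(H-halfSpace , _) (suc i) =
    let Aᵢ|Bᵢ = satSeq-separatedBy A|B i
    in H-halfSpace , σ-⊆ Aᵢ|Bᵢ , σ-⊆ (separatedBy-sym Aᵢ|Bᵢ)

  S-⊆ : ∀ {H A B} → SeparatedBy H A B → S G A B ⊆ᵖ ⟦ H ⟧
  S-⊆ A|B v (i , v∈σ) = σ-⊆ (satSeq-separatedBy A|B i) v v∈σ

  ⊆-S : ∀ (A B : VSet n) → A ⊆ᵖ S G A B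
  ⊆-S A B v v∈A =
    zero , ⊆-cl _ v (inj₁ (v , ⊆-cl _ v (inj₂ refl) , v∈A))

  separable⇒separable-S : ∀ {A B} → Separable G A B → Separable G (S G A B) (S G B A)
  separable⇒separable-S (H , A|B@(H-halfSpace , _)) =
    H , H-halfSpace , S-⊆ A|B , S-⊆ (separatedBy-sym A|B)

lemma10 : ∀ {n : ℕ} (G : Graph n) (A B : Subset n) → Connected G
          → Linked G ⟦ A ⟧ ⟦ B ⟧ → Convex G ⟦ A ⟧ → Convex G ⟦ B ⟧
          → Separable G ⟦ A ⟧ ⟦ B ⟧ ⇔ Separable G (S G ⟦ A ⟧ ⟦ B ⟧) (S G ⟦ B ⟧ ⟦ A ⟧)
lemma10 G A B _ _ _ _ =
  mk⇔ (separable⇒separable-S G)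
      (separable-mono G (⊆-S G ⟦ A ⟧ ⟦ B ⟧) (⊆-S G ⟦ B ⟧ ⟦ A ⟧))
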